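{- (1) Let $G$ be an icc-group and $H$ a soluble (respectively nilpotent) subgroup of $G$. Then there is a definable soluble (respectively nilpotent) subgroup $D$ of $G$ containing $H$, of the same derived length (respectively nilpotency class) as $H$, such that $N_G(H)\le N_G(D)$; moreover the defining formula for $D$ depends only on the derived length (respectively class). (2) Let $G$ be a sub-icc group and $H$ a soluble (respectively nilpotent) subgroup of $G$. Then there is a relatively definable soluble (respectively nilpotent) subgroup $D$ of $G$ containing $H$, of the same derived length (respectively nilpotency class) as $H$, such that $N_G(H)\le N_G(D)$; moreover the relative defining formula for $D$ depends only on the derived length (respectively class).
   Context: For a group $X$, a definable subgroup is one of the form $\phi(X,\bar a)=\{g\in X: X\models\phi(g,\bar a)\}$ for a first-order formula $\phi(x,\bar y)$ in the language of groups and parameters $\bar a$ from $X$. $X$ is an icc-group if for each formula $\phi(x,\bar y)$ there is a bound $n_\phi$ on the length of every chain of subgroups each of which is an intersection $\bigcap_i\phi(X,\bar a_i)$ of subgroups defined by $\phi$. A group $G$ is sub-icc if it is a subgroup of an icc-group $X$; a subgroup of $G$ is relatively definable if it equals $D\cap G$ for a definable subgroup $D$ of $X$, and its relative defining formula is the formula defining such a $D$. -}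

module Defs where

open import Level using (Level; _⊔_; Lift; lift; Setω)
open import Algebra.Bundles using (Group)
open import Data.Nat using (ℕ; zero; suc; _≤_; _<_)
open import Data.Fin using (Fin)
open import Data.Vec.Functional using (_∷_)
open import Data.Product using (Σ; ∃; _×_; _,_)
open import Data.Sum using (_⊎_)
open import Relation.Nullary using (¬_; Dec)

data Term (n : ℕ) : Set where
  var  : Fin n → Term n
  one  : Term n
  _·_  : Term n → Term n → Term n
  inv  : Term n → Term n

data Formula (n : ℕ) : Set where
  _≐_  : Term n → Term n → Formula n
  neg  : Formula n → Formula n
  _∧f_ : Formula n → Formula n → Formula n
  _∨f_ : Formula n → Formula n → Formula n
  _⇒f_ : Formula n → Formula n → Formula n
  all  : Formula (suc n) → Formula n
  ex   : Formula (suc n) → Formula n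

ExcludedMiddle : Setω
ExcludedMiddle = ∀ {a} (P : Set a) → Dec P

module GroupNotions {c ℓ : Level} (X : Group c ℓ) where
  open Group X

  Subset : (h : Level) → Set (c ⊔ Level.suc h)
  Subset h = Carrier → Set h

  _⊆_ : ∀ {h k} → Subset h → Subset k → Set (c ⊔ h ⊔ k)
  A ⊆ B = ∀ x → A x → B x

  _⊂_ : ∀ {h k} → Subset h → Subset k → Set (c ⊔ h ⊔ k)
  A ⊂ B = (A ⊆ B) × ¬ (B ⊆ A)

  _∩_ : ∀ {h k} → Subset h → Subset k → Subset (h ⊔ k)
  (A ∩ B) x = A x × B x

  record IsSubgroup {h} (H : Subset h) : Set (c ⊔ ℓ ⊔ h) where
    field
      respects : ∀ {x y} → x ≈ y → H x → H y
      has-ε    : H ε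
      closed-∙ : ∀ {x y} → H x → H y → H (x ∙ y)
      closed-⁻¹ : ∀ {x} → H x → H (x ⁻¹)

  Env : ℕ → Set c
  Env n = Fin n → Carrier

  eval : ∀ {n} → Term n → Env n → Carrier
  eval (var i) ρ = ρ i
  eval one ρ = ε
  eval (t · u) ρ = eval t ρ ∙ eval u ρ
  eval (inv t) ρ = eval t ρ ⁻¹

  Sat : ∀ {n} → Formula n → Env n → Set (c ⊔ ℓ)
  Sat (t ≐ u) ρ = Lift c (eval t ρ ≈ eval u ρ)
  Sat (neg φ) ρ = ¬ Sat φ ρ
  Sat (φ ∧f ψ) ρ = Sat φ ρ × Sat ψ ρ
  Sat (φ ∨f ψ) ρ = Sat φ ρ ⊎ Sat ψ ρ
  Sat (φ ⇒f ψ) ρ = Sat φ ρ → Sat ψ ρ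
  Sat (all φ) ρ = (x : Carrier) → Sat φ (x ∷ ρ)
  Sat (ex φ) ρ = Σ Carrier λ x → Sat φ (x ∷ ρ)

  -- φ(X, ā) = { g ∈ X : X ⊨ φ(g, ā) } for a formula φ(x, ȳ), |ȳ| = m
  Defined : ∀ {m} → Formula (suc m) → Env m → Subset (c ⊔ ℓ)
  Defined φ a g = Sat φ (g ∷ a)

  ⋂Defined : ∀ {m} → Formula (suc m) → (Env m → Set (c ⊔ ℓ)) → Subset (c ⊔ ℓ)
  ⋂Defined φ A g = ∀ a → A a → Sat φ (g ∷ a)

  -- icc: for each φ(x, ȳ) there is a bound N on the length n of every
  -- chain C₀ ⊋ C₁ ⊋ … ⊋ Cₙ of intersections of subgroups defined by φ
  IsIcc : Set (Level.suc (c ⊔ ℓ))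
  IsIcc = ∀ {m} (φ : Formula (suc m)) → ∃ λ (N : ℕ) →
    (n : ℕ) (C : ℕ → Env m → Set (c ⊔ ℓ)) →
    (∀ i → i ≤ n → ∀ a → C i a → IsSubgroup (Defined φ a)) →
    (∀ i → i < n → ⋂Defined φ (C (suc i)) ⊂ ⋂Defined φ (C i)) →
    n ≤ N

  Normalizer : ∀ {h} → Subset h → Subset (c ⊔ h)
  Normalizer H g = ∀ x → (H x → H (g ∙ x ∙ g ⁻¹)) × (H (g ∙ x ∙ g ⁻¹) → H x)

  data Gen {h} (S : Subset h) : Carrier → Set (c ⊔ ℓ ⊔ h) where
    gen  : ∀ {x} → S x → Gen S x
    gε   : Gen S ε
    g∙   : ∀ {x y} → Gen S x → Gen S y → Gen S (x ∙ y)
    g⁻¹  : ∀ {x} → Gen S x → Gen S (x ⁻¹)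
    gresp : ∀ {x y} → x ≈ y → Gen S x → Gen S y

  [_,_] : Carrier → Carrier → Carrier
  [ a , b ] = a ⁻¹ ∙ b ⁻¹ ∙ a ∙ b

  CommSub : ∀ {h} → Subset h → Subset h → Subset (c ⊔ ℓ ⊔ h)
  CommSub A B = Gen (λ x → Σ Carrier λ a → Σ Carrier λ b → A a × B b × x ≈ [ a , b ])

  IsTrivial : ∀ {h} → Subset h → Set (c ⊔ ℓ ⊔ h)
  IsTrivial A = ∀ x → A x → x ≈ ε

  Derived : ∀ {h} → Subset h → ℕ → Subset (c ⊔ ℓ ⊔ h)
  Derived {h} H zero x = Lift (c ⊔ ℓ) (H x)
  Derived H (suc k) = CommSub (Derived H k) (Derived H k)

  -- lower central series: γ₀ = H, γₖ₊₁ = [γₖ, H]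
  -- (γₖ here is γₖ₊₁ in the usual 1-based numbering)
  LowerCentral : ∀ {h} → Subset h → ℕ → Subset (c ⊔ ℓ ⊔ h)
  LowerCentral {h} H zero x = Lift (c ⊔ ℓ) (H x)
  LowerCentral {h} H (suc k) = CommSub (LowerCentral H k) (λ x → Lift (c ⊔ ℓ) (H x))

  HasDerivedLength : ∀ {h} → Subset h → ℕ → Set (c ⊔ ℓ ⊔ h)
  HasDerivedLength H d =
    IsTrivial (Derived H d) × (∀ k → k < d → ¬ IsTrivial (Derived H k))

  HasNilpotencyClass : ∀ {h} → Subset h → ℕ → Set (c ⊔ ℓ ⊔ h)
  HasNilpotencyClass H d =
    IsTrivial (LowerCentral H d) × (∀ k → k < d → ¬ IsTrivial (LowerCentral H k))

-- (1) soluble case, G an icc-group.  The formula φ(x, ȳ) is chosen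
-- depending only on (G and) the derived length d, not on H.
IccSoluble : (c ℓ h : Level) → Set (Level.suc (c ⊔ ℓ ⊔ h))
IccSoluble c ℓ h = (G : Group c ℓ) → let open GroupNotions G in
  IsIcc → (d : ℕ) →
  Σ ℕ λ m → Σ (Formula (suc m)) λ φ →
  (H : Subset h) → IsSubgroup H → HasDerivedLength H d →
  Σ (Env m) λ a →
    IsSubgroup (Defined φ a) × (H ⊆ Defined φ a) ×
    HasDerivedLength (Defined φ a) d ×
    (Normalizer H ⊆ Normalizer (Defined φ a))

IccNilpotent : (c ℓ h : Level) → Set (Level.suc (c ⊔ ℓ ⊔ h))
IccNilpotent c ℓ h = (G : Group c ℓ) → let open GroupNotions G in
  IsIcc → (d : ℕ) →
  Σ ℕ λ m → Σ (Formula (suc m)) λ φ →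
  (H : Subset h) → IsSubgroup H → HasNilpotencyClass H d →
  Σ (Env m) λ a →
    IsSubgroup (Defined φ a) × (H ⊆ Defined φ a) ×
    HasNilpotencyClass (Defined φ a) d ×
    (Normalizer H ⊆ Normalizer (Defined φ a))

-- (2) soluble case: G a subgroup of an icc-group X; subgroups of G are
-- subgroups of X contained in G; D = φ(X, ā) ∩ G is relatively definable
-- with relative defining formula φ; N_G(H) = N_X(H) ∩ G.
SubIccSoluble : (c ℓ g h : Level) → Set (Level.suc (c ⊔ ℓ ⊔ g ⊔ h))
SubIccSoluble c ℓ g h = (X : Group c ℓ) → let open GroupNotions X in
  IsIcc → (G : Subset g) → IsSubgroup G → (d : ℕ) →
  Σ ℕ λ m → Σ (Formula (suc m)) λ φ →
  (H : Subset h) → IsSubgroup H → H ⊆ G → HasDerivedLength H d →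
  Σ (Env m) λ a →
    IsSubgroup (Defined φ a) × (H ⊆ (Defined φ a ∩ G)) ×
    HasDerivedLength (Defined φ a ∩ G) d ×
    ((Normalizer H ∩ G) ⊆ (Normalizer (Defined φ a ∩ G) ∩ G))

SubIccNilpotent : (c ℓ g h : Level) → Set (Level.suc (c ⊔ ℓ ⊔ g ⊔ h))
SubIccNilpotent c ℓ g h = (X : Group c ℓ) → let open GroupNotions X in
  IsIcc → (G : Subset g) → IsSubgroup G → (d : ℕ) →
  Σ ℕ λ m → Σ (Formula (suc m)) λ φ →
  (H : Subset h) → IsSubgroup H → H ⊆ G → HasNilpotencyClass H d →
  Σ (Env m) λ a →
    IsSubgroup (Defined φ a) × (H ⊆ (Defined φ a ∩ G)) ×
    HasNilpotencyClass (Defined φ a ∩ G) d ×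
    ((Normalizer H ∩ G) ⊆ (Normalizer (Defined φ a ∩ G) ∩ G))

module Submission where

-- D is built from iterated centralisers modulo a subgroup,
--   CentMod Z S = { g ∈ N(Z) : [g, s] ∈ Z for all s ∈ S },
-- by a double-centraliser construction in the soluble case and by the upper
-- central series of H relative to X in the nilpotent case.  Each step is
-- invariant under N(H), so N(H) ≤ N(D).  Definability comes from icc: an
-- arbitrary intersection of ψ-definable subgroups is the intersection of a
-- bounded number of them (an argument by excluded middle), so CentMod Z S is
-- defined by a formula depending only on one defining Z.

open import Level using (Level; _⊔_; Lift; lift; lower; Setω)
open import Algebra.Bundles using (Group)
open import Data.Nat using (ℕ; zero; suc; _+_; _≤_; _<_; z≤n; s≤s; _≤?_)
open import Data.Nat.Properties
  using (≤-refl; <⇒≤; ≰⇒>; <⇒≱; 1+n≰n; m≤n⇒m≤1+n; m≤n⇒m<n∨m≡n; m<1+n⇒m≤n; m<1+n⇒m<n∨m≡n;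
         m≤m+n; +-suc; +-identityʳ)
open import Data.Fin using (Fin; zero; suc; _↑ˡ_; _↑ʳ_)
open import Data.Product using (Σ; _×_; _,_; proj₁; proj₂)
open import Data.Product.Function.NonDependent.Propositional using (_×-⇔_)
open import Data.Sum using (inj₁; inj₂; [_,_]′)
open import Data.Sum.Function.Propositional using (_⊎-⇔_)
open import Function.Bundles using (_⇔_; mk⇔; module Equivalence)
open import Function.Properties.Equivalence using () renaming (trans to ⇔-trans)
open import Function.Related.TypeIsomorphisms using (¬-cong-⇔; →-cong-⇔)
open import Data.Empty using (⊥; ⊥-elim)
open import Relation.Nullary using (¬_; yes; no)
open import Relation.Nullary.Decidable using (True; toWitness; fromWitness; decidable-stable)
import Relation.Binary.PropositionalEquality as P
open P using (_≡_)
open import Defs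
open Equivalence using (to; from)

-- Deciding equations in the free group on n generators: a group expression
-- is reduced to a freely reduced word (a list of letters x or x⁻¹), and two
-- expressions with the same reduced word are equal in every group under
-- every assignment of the generators.
module FreeGroupSolver {c ℓ : Level} (G : Group c ℓ) where
  open Group G
  open import Algebra.Properties.Group G using (⁻¹-involutive; ⁻¹-anti-homo-∙; ε⁻¹≈ε)
  open import Relation.Binary.Reasoning.Setoid setoid
  open import Data.Bool using (Bool; true; false; not)
  open import Data.List using (List; []; _∷_)
  open import Data.Fin using (_≟_)

  infixl 7 _⊗_
  infix 8 _ᴵ

  data Expr (n : ℕ) : Set where
    ‹_› : Fin n → Expr n
    ι   : Expr n
    _⊗_ : Expr n → Expr n → Expr n
    _ᴵ  : Expr n → Expr n

  ⟦_⟧ : ∀ {n} → Expr n → (Fin n → Carrier) → Carrier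
  ⟦ ‹ i › ⟧ ρ = ρ i
  ⟦ ι ⟧ ρ = ε
  ⟦ a ⊗ b ⟧ ρ = ⟦ a ⟧ ρ ∙ ⟦ b ⟧ ρ
  ⟦ a ᴵ ⟧ ρ = ⟦ a ⟧ ρ ⁻¹

  -- a letter is a generator (true) or its inverse (false)
  Letter : ℕ → Set
  Letter n = Fin n × Bool

  Word : ℕ → Set
  Word n = List (Letter n)

  ⟦_⟧ₗ : ∀ {n} → Letter n → (Fin n → Carrier) → Carrier
  ⟦ i , true ⟧ₗ ρ = ρ i
  ⟦ i , false ⟧ₗ ρ = ρ i ⁻¹

  ⟦_⟧w : ∀ {n} → Word n → (Fin n → Carrier) → Carrier
  ⟦ [] ⟧w ρ = ε
  ⟦ l ∷ w ⟧w ρ = ⟦ l ⟧ₗ ρ ∙ ⟦ w ⟧w ρ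

  _◃_ : ∀ {n} → Letter n → Word n → Word n
  l ◃ [] = l ∷ []
  (i , true) ◃ ((j , true) ∷ w) = (i , true) ∷ (j , true) ∷ w
  (i , false) ◃ ((j , false) ∷ w) = (i , false) ∷ (j , false) ∷ w
  (i , true) ◃ ((j , false) ∷ w) with i ≟ j
  ... | yes _ = w
  ... | no _ = (i , true) ∷ (j , false) ∷ w
  (i , false) ◃ ((j , true) ∷ w) with i ≟ j
  ... | yes _ = w
  ... | no _ = (i , false) ∷ (j , true) ∷ w

  cancel-inverseʳ : ∀ x y → y ≈ x ∙ (x ⁻¹ ∙ y)
  cancel-inverseʳ x y = begin
    y              ≈⟨ sym (identityˡ y) ⟩
    ε ∙ y          ≈⟨ ∙-congʳ (sym (inverseʳ x)) ⟩
    (x ∙ x ⁻¹) ∙ y ≈⟨ assoc x (x ⁻¹) y ⟩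
    x ∙ (x ⁻¹ ∙ y) ∎

  cancel-inverseˡ : ∀ x y → y ≈ x ⁻¹ ∙ (x ∙ y)
  cancel-inverseˡ x y = begin
    y              ≈⟨ sym (identityˡ y) ⟩
    ε ∙ y          ≈⟨ ∙-congʳ (sym (inverseˡ x)) ⟩
    (x ⁻¹ ∙ x) ∙ y ≈⟨ assoc (x ⁻¹) x y ⟩
    x ⁻¹ ∙ (x ∙ y) ∎

  ◃-sound : ∀ {n} (l : Letter n) w ρ → ⟦ l ◃ w ⟧w ρ ≈ ⟦ l ⟧ₗ ρ ∙ ⟦ w ⟧w ρ
  ◃-sound l [] ρ = refl
  ◃-sound (i , true) ((j , true) ∷ w) ρ = refl
  ◃-sound (i , false) ((j , false) ∷ w) ρ = refl
  ◃-sound (i , true) ((j , false) ∷ w) ρ with i ≟ j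
  ... | yes P.refl = cancel-inverseʳ (ρ i) (⟦ w ⟧w ρ)
  ... | no _ = refl
  ◃-sound (i , false) ((j , true) ∷ w) ρ with i ≟ j
  ... | yes P.refl = cancel-inverseˡ (ρ i) (⟦ w ⟧w ρ)
  ... | no _ = refl

  _⊙_ : ∀ {n} → Word n → Word n → Word n
  [] ⊙ w = w
  (l ∷ u) ⊙ w = l ◃ (u ⊙ w)

  ⊙-sound : ∀ {n} (u w : Word n) ρ → ⟦ u ⊙ w ⟧w ρ ≈ ⟦ u ⟧w ρ ∙ ⟦ w ⟧w ρ
  ⊙-sound [] w ρ = sym (identityˡ _)
  ⊙-sound (l ∷ u) w ρ = begin
    ⟦ l ◃ (u ⊙ w) ⟧w ρ              ≈⟨ ◃-sound l (u ⊙ w) ρ ⟩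
    ⟦ l ⟧ₗ ρ ∙ ⟦ u ⊙ w ⟧w ρ           ≈⟨ ∙-congˡ (⊙-sound u w ρ) ⟩
    ⟦ l ⟧ₗ ρ ∙ (⟦ u ⟧w ρ ∙ ⟦ w ⟧w ρ)  ≈⟨ sym (assoc _ _ _) ⟩
    (⟦ l ⟧ₗ ρ ∙ ⟦ u ⟧w ρ) ∙ ⟦ w ⟧w ρ  ∎

  invert-letter : ∀ {n} → Letter n → Letter n
  invert-letter (i , b) = (i , not b)

  invert-letter-sound : ∀ {n} (l : Letter n) ρ → ⟦ invert-letter l ⟧ₗ ρ ≈ ⟦ l ⟧ₗ ρ ⁻¹
  invert-letter-sound (i , true) ρ = refl
  invert-letter-sound (i , false) ρ = sym (⁻¹-involutive _)

  invert : ∀ {n} → Word n → Word n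
  invert [] = []
  invert (l ∷ u) = invert u ⊙ (invert-letter l ∷ [])

  invert-sound : ∀ {n} (u : Word n) ρ → ⟦ invert u ⟧w ρ ≈ ⟦ u ⟧w ρ ⁻¹
  invert-sound [] ρ = sym ε⁻¹≈ε
  invert-sound (l ∷ u) ρ = begin
    ⟦ invert u ⊙ (invert-letter l ∷ []) ⟧w ρ   ≈⟨ ⊙-sound (invert u) _ ρ ⟩
    ⟦ invert u ⟧w ρ ∙ (⟦ invert-letter l ⟧ₗ ρ ∙ ε) ≈⟨ ∙-cong (invert-sound u ρ) (identityʳ _) ⟩
    ⟦ u ⟧w ρ ⁻¹ ∙ ⟦ invert-letter l ⟧ₗ ρ      ≈⟨ ∙-congˡ (invert-letter-sound l ρ) ⟩
    ⟦ u ⟧w ρ ⁻¹ ∙ ⟦ l ⟧ₗ ρ ⁻¹                ≈⟨ sym (⁻¹-anti-homo-∙ _ _) ⟩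
    (⟦ l ⟧ₗ ρ ∙ ⟦ u ⟧w ρ) ⁻¹                 ∎

  normalise : ∀ {n} → Expr n → Word n
  normalise ‹ i › = (i , true) ∷ []
  normalise ι = []
  normalise (a ⊗ b) = normalise a ⊙ normalise b
  normalise (a ᴵ) = invert (normalise a)

  normalise-sound : ∀ {n} (e : Expr n) ρ → ⟦ normalise e ⟧w ρ ≈ ⟦ e ⟧ ρ
  normalise-sound ‹ i › ρ = identityʳ _
  normalise-sound ι ρ = refl
  normalise-sound (a ⊗ b) ρ =
    trans (⊙-sound (normalise a) (normalise b) ρ) (∙-cong (normalise-sound a ρ) (normalise-sound b ρ))
  normalise-sound (a ᴵ) ρ = trans (invert-sound (normalise a) ρ) (⁻¹-cong (normalise-sound a ρ))

  prove : ∀ {n} (lhs rhs : Expr n) → normalise lhs ≡ normalise rhs → ∀ ρ → ⟦ lhs ⟧ ρ ≈ ⟦ rhs ⟧ ρ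
  prove lhs rhs same ρ = begin
    ⟦ lhs ⟧ ρ              ≈⟨ sym (normalise-sound lhs ρ) ⟩
    ⟦ normalise lhs ⟧w ρ   ≡⟨ P.cong (λ w → ⟦ w ⟧w ρ) same ⟩
    ⟦ normalise rhs ⟧w ρ   ≈⟨ normalise-sound rhs ρ ⟩
    ⟦ rhs ⟧ ρ              ∎
module GroupTheory {c ℓ : Level} (X : Group c ℓ) where
  open Group X
  open GroupNotions X
  open FreeGroupSolver X
  open import Algebra.Properties.Group X using (ε⁻¹≈ε)
  open import Data.Vec.Functional using (_∷_; [])

  conj : Carrier → Carrier → Carrier
  conj g x = g ∙ x ∙ g ⁻¹

  private
    pattern v₀ = ‹ zero ›
    pattern v₁ = ‹ suc zero ›
    pattern v₂ = ‹ suc (suc zero) ›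

    conjᴱ : ∀ {n} → Expr n → Expr n → Expr n
    conjᴱ a b = (a ⊗ b) ⊗ a ᴵ

    commᴱ : ∀ {n} → Expr n → Expr n → Expr n
    commᴱ a b = ((a ᴵ ⊗ b ᴵ) ⊗ a) ⊗ b

  conj-cong : ∀ g {x y} → x ≈ y → conj g x ≈ conj g y
  conj-cong g x≈y = ∙-congʳ (∙-congˡ x≈y)

  conj-congˡ : ∀ {g h} x → g ≈ h → conj g x ≈ conj h x
  conj-congˡ x g≈h = ∙-cong (∙-congʳ g≈h) (⁻¹-cong g≈h)

  conj-ε : ∀ g → conj g ε ≈ ε
  conj-ε g = prove (conjᴱ v₀ ι) ι P.refl (g ∷ [])

  conj-by-ε : ∀ x → conj ε x ≈ x
  conj-by-ε x = prove (conjᴱ ι v₀) v₀ P.refl (x ∷ [])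

  conj-∙ : ∀ g x y → conj g (x ∙ y) ≈ conj g x ∙ conj g y
  conj-∙ g x y = prove (conjᴱ v₀ (v₁ ⊗ v₂)) (conjᴱ v₀ v₁ ⊗ conjᴱ v₀ v₂) P.refl (g ∷ x ∷ y ∷ [])

  conj-⁻¹ : ∀ g x → conj g (x ⁻¹) ≈ conj g x ⁻¹
  conj-⁻¹ g x = prove (conjᴱ v₀ (v₁ ᴵ)) (conjᴱ v₀ v₁ ᴵ) P.refl (g ∷ x ∷ [])

  conj-∙-action : ∀ g h x → conj (g ∙ h) x ≈ conj g (conj h x)
  conj-∙-action g h x = prove (conjᴱ (v₀ ⊗ v₁) v₂) (conjᴱ v₀ (conjᴱ v₁ v₂)) P.refl (g ∷ h ∷ x ∷ [])

  conj-⁻¹-action : ∀ g h x → conj ((g ∙ h) ⁻¹) x ≈ conj (h ⁻¹) (conj (g ⁻¹) x)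
  conj-⁻¹-action g h x =
    prove (conjᴱ ((v₀ ⊗ v₁) ᴵ) v₂) (conjᴱ (v₁ ᴵ) (conjᴱ (v₀ ᴵ) v₂)) P.refl (g ∷ h ∷ x ∷ [])

  conj-cancelˡ : ∀ g x → conj (g ⁻¹) (conj g x) ≈ x
  conj-cancelˡ g x = prove (conjᴱ (v₀ ᴵ) (conjᴱ v₀ v₁)) v₁ P.refl (g ∷ x ∷ [])

  conj-cancelʳ : ∀ g x → conj g (conj (g ⁻¹) x) ≈ x
  conj-cancelʳ g x = prove (conjᴱ v₀ (conjᴱ (v₀ ᴵ) v₁)) v₁ P.refl (g ∷ x ∷ [])

  conj-by-⁻¹⁻¹ : ∀ g x → conj (g ⁻¹ ⁻¹) x ≈ conj g x
  conj-by-⁻¹⁻¹ g x = prove (conjᴱ (v₀ ᴵ ᴵ) v₁) (conjᴱ v₀ v₁) P.refl (g ∷ x ∷ [])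

  comm-cong : ∀ {a a′ b b′} → a ≈ a′ → b ≈ b′ → [ a , b ] ≈ [ a′ , b′ ]
  comm-cong a≈a′ b≈b′ = ∙-cong (∙-cong (∙-cong (⁻¹-cong a≈a′) (⁻¹-cong b≈b′)) a≈a′) b≈b′

  conj-comm : ∀ g x y → conj g [ x , y ] ≈ [ conj g x , conj g y ]
  conj-comm g x y =
    prove (conjᴱ v₀ (commᴱ v₁ v₂)) (commᴱ (conjᴱ v₀ v₁) (conjᴱ v₀ v₂)) P.refl (g ∷ x ∷ y ∷ [])

  comm-⁻¹-swap : ∀ x y → [ x , y ] ⁻¹ ≈ [ y , x ]
  comm-⁻¹-swap x y = prove (commᴱ v₀ v₁ ᴵ) (commᴱ v₁ v₀) P.refl (x ∷ y ∷ [])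

  comm-ε : ∀ s → [ ε , s ] ≈ ε
  comm-ε s = prove (commᴱ ι v₀) ι P.refl (s ∷ [])

  comm-∙ : ∀ g h s → [ g ∙ h , s ] ≈ conj (h ⁻¹) [ g , s ] ∙ [ h , s ]
  comm-∙ g h s =
    prove (commᴱ (v₀ ⊗ v₁) v₂) (conjᴱ (v₁ ᴵ) (commᴱ v₀ v₂) ⊗ commᴱ v₁ v₂) P.refl (g ∷ h ∷ s ∷ [])

  comm-⁻¹ : ∀ g s → [ g ⁻¹ , s ] ≈ conj g ([ g , s ] ⁻¹)
  comm-⁻¹ g s = prove (commᴱ (v₀ ᴵ) v₁) (conjᴱ v₀ (commᴱ v₀ v₁ ᴵ)) P.refl (g ∷ s ∷ [])

  comm-conj : ∀ g x s → [ conj g x , s ] ≈ conj g [ x , conj (g ⁻¹) s ]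
  comm-conj g x s =
    prove (commᴱ (conjᴱ v₀ v₁) v₂) (conjᴱ v₀ (commᴱ v₁ (conjᴱ (v₀ ᴵ) v₂))) P.refl (g ∷ x ∷ s ∷ [])

  _≅_ : ∀ {a b} → Subset a → Subset b → Set (c ⊔ a ⊔ b)
  A ≅ B = (A ⊆ B) × (B ⊆ A)

  ≅-sym : ∀ {a b} {A : Subset a} {B : Subset b} → A ≅ B → B ≅ A
  ≅-sym (A⊆B , B⊆A) = B⊆A , A⊆B

  Respects : ∀ {a} → Subset a → Set (c ⊔ ℓ ⊔ a)
  Respects A = ∀ {x y} → x ≈ y → A x → A y

  ConjClosed : ∀ {a} → Subset a → Carrier → Set (c ⊔ a)
  ConjClosed A g = ∀ x → A x → A (conj g x)

  normalizer-intro : ∀ {a} {A : Subset a} {g} →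
    Respects A → ConjClosed A g → ConjClosed A (g ⁻¹) → Normalizer A g
  normalizer-intro {g = g} resp into into⁻¹ x =
    into x , λ A[gxg⁻¹] → resp (conj-cancelˡ g x) (into⁻¹ _ A[gxg⁻¹])

  normalizer-⁻¹ : ∀ {a} {A : Subset a} {g} → Respects A → Normalizer A g → Normalizer A (g ⁻¹)
  normalizer-⁻¹ {g = g} resp N = normalizer-intro resp
    (λ x Ax → proj₂ (N (conj (g ⁻¹) x)) (resp (sym (conj-cancelʳ g x)) Ax))
    (λ x Ax → resp (sym (conj-by-⁻¹⁻¹ g x)) (proj₁ (N x) Ax))

  normalizer-subgroup : ∀ {a} {A : Subset a} → Respects A → IsSubgroup (Normalizer A)
  normalizer-subgroup resp = record
    { respects = λ g≈g′ N → normalizer-intro resp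
        (λ x Ax → resp (conj-congˡ x g≈g′) (proj₁ (N x) Ax))
        (λ x Ax → resp (conj-congˡ x (⁻¹-cong g≈g′)) (proj₁ (normalizer-⁻¹ resp N x) Ax))
    ; has-ε = normalizer-intro resp
        (λ x Ax → resp (sym (conj-by-ε x)) Ax)
        (λ x Ax → resp (trans (sym (conj-by-ε x)) (conj-congˡ x (sym ε⁻¹≈ε))) Ax)
    ; closed-∙ = λ {g} {h} Ng Nh → normalizer-intro resp
        (λ x Ax → resp (sym (conj-∙-action g h x)) (proj₁ (Ng _) (proj₁ (Nh x) Ax)))
        (λ x Ax → resp (sym (conj-⁻¹-action g h x))
           (proj₁ (normalizer-⁻¹ resp Nh _) (proj₁ (normalizer-⁻¹ resp Ng x) Ax)))
    ; closed-⁻¹ = normalizer-⁻¹ resp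
    }

  module SubgroupProperties {a} {A : Subset a} (subA : IsSubgroup A) where
    open IsSubgroup subA

    conj-closed : ∀ {g x} → A g → A x → A (conj g x)
    conj-closed Ag Ax = closed-∙ (closed-∙ Ag Ax) (closed-⁻¹ Ag)

    comm-closed : ∀ {x y} → A x → A y → A [ x , y ]
    comm-closed Ax Ay = closed-∙ (closed-∙ (closed-∙ (closed-⁻¹ Ax) (closed-⁻¹ Ay)) Ax) Ay

    ⊆-normalizer : A ⊆ Normalizer A
    ⊆-normalizer g Ag =
      normalizer-intro respects (λ x → conj-closed Ag) (λ x → conj-closed (closed-⁻¹ Ag))

    comm-swap : ∀ {x y} → A [ x , y ] → A [ y , x ]
    comm-swap A[x,y] = respects (comm-⁻¹-swap _ _) (closed-⁻¹ A[x,y])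

  subgroup-≅ : ∀ {a b} {A : Subset a} {B : Subset b} → A ≅ B → IsSubgroup A → IsSubgroup B
  subgroup-≅ (A⊆B , B⊆A) subA = record
    { respects = λ x≈y Bx → A⊆B _ (respects x≈y (B⊆A _ Bx))
    ; has-ε = A⊆B _ has-ε
    ; closed-∙ = λ Bx By → A⊆B _ (closed-∙ (B⊆A _ Bx) (B⊆A _ By))
    ; closed-⁻¹ = λ Bx → A⊆B _ (closed-⁻¹ (B⊆A _ Bx))
    }
    where open IsSubgroup subA

  normalizer-≅ : ∀ {a b} {A : Subset a} {B : Subset b} → A ≅ B → Normalizer A ⊆ Normalizer B
  normalizer-≅ (A⊆B , B⊆A) g N x =
    (λ Bx → A⊆B _ (proj₁ (N x) (B⊆A _ Bx))) , (λ Bx → A⊆B _ (proj₂ (N x) (B⊆A _ Bx)))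

  ∩-subgroup : ∀ {a b} {A : Subset a} {B : Subset b} → IsSubgroup A → IsSubgroup B → IsSubgroup (A ∩ B)
  ∩-subgroup subA subB = record
    { respects = λ x≈y (Ax , Bx) → A.respects x≈y Ax , B.respects x≈y Bx
    ; has-ε = A.has-ε , B.has-ε
    ; closed-∙ = λ (Ax , Bx) (Ay , By) → A.closed-∙ Ax Ay , B.closed-∙ Bx By
    ; closed-⁻¹ = λ (Ax , Bx) → A.closed-⁻¹ Ax , B.closed-⁻¹ Bx
    }
    where
    module A = IsSubgroup subA
    module B = IsSubgroup subB

  ∩-normalizer : ∀ {a b} {A : Subset a} {B : Subset b} →
    (Normalizer A ∩ Normalizer B) ⊆ Normalizer (A ∩ B)
  ∩-normalizer g (NA , NB) x =
    (λ (Ax , Bx) → proj₁ (NA x) Ax , proj₁ (NB x) Bx) , (λ (Ax , Bx) → proj₂ (NA x) Ax , proj₂ (NB x) Bx)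

  Trivial : ∀ h → Subset (c ⊔ ℓ ⊔ h)
  Trivial h x = Lift (c ⊔ h) (x ≈ ε)

  trivial-subgroup : ∀ h → IsSubgroup (Trivial h)
  trivial-subgroup h = record
    { respects = λ x≈y x≈ε → lift (trans (sym x≈y) (lower x≈ε))
    ; has-ε = lift refl
    ; closed-∙ = λ x≈ε y≈ε → lift (trans (∙-cong (lower x≈ε) (lower y≈ε)) (identityˡ ε))
    ; closed-⁻¹ = λ x≈ε → lift (trans (⁻¹-cong (lower x≈ε)) ε⁻¹≈ε)
    }

  trivial-normal : ∀ h g → Normalizer (Trivial h) g
  trivial-normal h g = normalizer-intro (IsSubgroup.respects (trivial-subgroup h))
    (λ x x≈ε → lift (trans (conj-cong g (lower x≈ε)) (conj-ε g)))
    (λ x x≈ε → lift (trans (conj-cong (g ⁻¹) (lower x≈ε)) (conj-ε (g ⁻¹))))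

  CentMod₁ : ∀ {z} → Subset z → Carrier → Subset (c ⊔ z)
  CentMod₁ Z s g = Normalizer Z g × Z [ g , s ]

  CentMod : ∀ {z b} → Subset z → Subset b → Subset (c ⊔ z ⊔ b)
  CentMod Z S g = Normalizer Z g × (∀ s → S s → Z [ g , s ])

  module CentModProperties {z} {Z : Subset z} (subZ : IsSubgroup Z) where
    open IsSubgroup subZ
    module NZ = IsSubgroup (normalizer-subgroup {A = Z} respects)

    centMod₁-subgroup : ∀ s → IsSubgroup (CentMod₁ Z s)
    centMod₁-subgroup s = record
      { respects = λ g≈g′ (Ng , Z[g,s]) → NZ.respects g≈g′ Ng , respects (comm-cong g≈g′ refl) Z[g,s]
      ; has-ε = NZ.has-ε , respects (sym (comm-ε s)) has-ε
      ; closed-∙ = λ {g} {h} (Ng , Z[g,s]) (Nh , Z[h,s]) → NZ.closed-∙ Ng Nh ,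
          respects (sym (comm-∙ g h s)) (closed-∙ (proj₁ (NZ.closed-⁻¹ Nh _) Z[g,s]) Z[h,s])
      ; closed-⁻¹ = λ {g} (Ng , Z[g,s]) → NZ.closed-⁻¹ Ng ,
          respects (sym (comm-⁻¹ g s)) (proj₁ (Ng _) (closed-⁻¹ Z[g,s]))
      }

    centMod-subgroup : ∀ {b} (S : Subset b) → IsSubgroup (CentMod Z S)
    centMod-subgroup S = record
      { respects = λ g≈g′ (Ng , f) → NZ.respects g≈g′ Ng , λ s Ss →
          proj₂ (Cs.respects s g≈g′ (Ng , f s Ss))
      ; has-ε = NZ.has-ε , λ s Ss → proj₂ (Cs.has-ε s)
      ; closed-∙ = λ (Ng , f) (Nh , f′) → NZ.closed-∙ Ng Nh , λ s Ss →
          proj₂ (Cs.closed-∙ s (Ng , f s Ss) (Nh , f′ s Ss))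
      ; closed-⁻¹ = λ (Ng , f) → NZ.closed-⁻¹ Ng , λ s Ss → proj₂ (Cs.closed-⁻¹ s (Ng , f s Ss))
      }
      where module Cs s = IsSubgroup (centMod₁-subgroup s)

    centMod-conj-closed : ∀ {b} {S : Subset b} → Respects S →
      ∀ g → Normalizer Z g → Normalizer S g → ConjClosed (CentMod Z S) g
    centMod-conj-closed respS g NZg NSg x (NZx , f) =
      NZ.closed-∙ (NZ.closed-∙ NZg NZx) (NZ.closed-⁻¹ NZg) , λ s Ss →
        respects (sym (comm-conj g x s)) (proj₁ (NZg _) (f _ (proj₁ (normalizer-⁻¹ respS NSg s) Ss)))

    centMod-normalizer : ∀ {b} {S : Subset b} → Respects S →
      (Normalizer Z ∩ Normalizer S) ⊆ Normalizer (CentMod Z S)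
    centMod-normalizer respS g (NZg , NSg) = normalizer-intro (IsSubgroup.respects (centMod-subgroup _))
      (centMod-conj-closed respS g NZg NSg)
      (centMod-conj-closed respS (g ⁻¹) (normalizer-⁻¹ respects NZg) (normalizer-⁻¹ respS NSg))

  gen-subgroup : ∀ {b} (S : Subset b) → IsSubgroup (Gen S)
  gen-subgroup S = record { respects = gresp ; has-ε = gε ; closed-∙ = g∙ ; closed-⁻¹ = g⁻¹ }

  gen-least : ∀ {b t} {S : Subset b} {T : Subset t} → IsSubgroup T → S ⊆ T → Gen S ⊆ T
  gen-least subT S⊆T x (gen Sx) = S⊆T x Sx
  gen-least subT S⊆T _ gε = IsSubgroup.has-ε subT
  gen-least subT S⊆T _ (g∙ p q) = IsSubgroup.closed-∙ subT (gen-least subT S⊆T _ p) (gen-least subT S⊆T _ q)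
  gen-least subT S⊆T _ (g⁻¹ p) = IsSubgroup.closed-⁻¹ subT (gen-least subT S⊆T _ p)
  gen-least subT S⊆T _ (gresp x≈y p) = IsSubgroup.respects subT x≈y (gen-least subT S⊆T _ p)

  gen-mono : ∀ {b b′} {S : Subset b} {S′ : Subset b′} → S ⊆ S′ → Gen S ⊆ Gen S′
  gen-mono {S′ = S′} S⊆S′ = gen-least (gen-subgroup S′) (λ x Sx → gen (S⊆S′ x Sx))

  gen-conj : ∀ {b b′} {S : Subset b} {S′ : Subset b′} g →
    (∀ x → S x → Gen S′ (conj g x)) → ∀ x → Gen S x → Gen S′ (conj g x)
  gen-conj g f x (gen Sx) = f x Sx
  gen-conj g f _ gε = gresp (sym (conj-ε g)) gε
  gen-conj g f _ (g∙ {x} {y} p q) = gresp (sym (conj-∙ g x y)) (g∙ (gen-conj g f _ p) (gen-conj g f _ q))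
  gen-conj g f _ (g⁻¹ {x} p) = gresp (sym (conj-⁻¹ g x)) (g⁻¹ (gen-conj g f _ p))
  gen-conj g f _ (gresp x≈y p) = gresp (conj-cong g x≈y) (gen-conj g f _ p)

  commSub-least : ∀ {b t} {A B : Subset b} {T : Subset t} → IsSubgroup T →
    (∀ a b → A a → B b → T [ a , b ]) → CommSub A B ⊆ T
  commSub-least subT f = gen-least subT λ { x (a , b , Aa , Bb , x≈[a,b]) →
    IsSubgroup.respects subT (sym x≈[a,b]) (f a b Aa Bb) }

  commSub-mono : ∀ {b b′} {A B : Subset b} {A′ B′ : Subset b′} → A ⊆ A′ → B ⊆ B′ →
    CommSub A B ⊆ CommSub A′ B′
  commSub-mono A⊆A′ B⊆B′ = gen-mono λ { x (a , b , Aa , Bb , x≈[a,b]) →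
    a , b , A⊆A′ a Aa , B⊆B′ b Bb , x≈[a,b] }

  commSub-conj : ∀ {b} {A B : Subset b} g → ConjClosed A g → ConjClosed B g → ConjClosed (CommSub A B) g
  commSub-conj g conjA conjB = gen-conj g λ { x (a , b , Aa , Bb , x≈[a,b]) →
    gen (conj g a , conj g b , conjA a Aa , conjB b Bb , trans (conj-cong g x≈[a,b]) (conj-comm g a b)) }

  derived-mono : ∀ {a b} {A : Subset a} {B : Subset b} → A ⊆ B → ∀ n → Derived A n ⊆ Derived B n
  derived-mono A⊆B zero x Ax = lift (A⊆B x (lower Ax))
  derived-mono A⊆B (suc n) = commSub-mono (derived-mono A⊆B n) (derived-mono A⊆B n)

  lowerCentral-mono : ∀ {a b} {A : Subset a} {B : Subset b} → A ⊆ B → ∀ n →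
    LowerCentral A n ⊆ LowerCentral B n
  lowerCentral-mono A⊆B zero x Ax = lift (A⊆B x (lower Ax))
  lowerCentral-mono A⊆B (suc n) = commSub-mono (lowerCentral-mono A⊆B n) (λ x Ax → lift (A⊆B x (lower Ax)))

  derived-shift : ∀ {a} {A : Subset a} n → Derived A (suc n) ⊆ Derived (Derived A 1) n
  derived-shift zero x p = lift p
  derived-shift (suc n) = commSub-mono (derived-shift n) (derived-shift n)

  module SeriesProperties {h} {H : Subset h} (subH : IsSubgroup H) where
    open IsSubgroup subH
    open SubgroupProperties subH

    derived-⊆ : ∀ n → Derived H n ⊆ H
    derived-⊆ zero x Hx = lower Hx
    derived-⊆ (suc n) = commSub-least subH λ a b Aa Bb → comm-closed (derived-⊆ n a Aa) (derived-⊆ n b Bb)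

    derived-respects : ∀ n → Respects (Derived H n)
    derived-respects zero x≈y Hx = lift (respects x≈y (lower Hx))
    derived-respects (suc n) x≈y p = gresp x≈y p

    derived-conj : ∀ n g → Normalizer H g → ConjClosed (Derived H n) g
    derived-conj zero g N x Hx = lift (proj₁ (N x) (lower Hx))
    derived-conj (suc n) g N = commSub-conj g (derived-conj n g N) (derived-conj n g N)

    derived-normalizer : ∀ n → Normalizer H ⊆ Normalizer (Derived H n)
    derived-normalizer n g N = normalizer-intro (derived-respects n)
      (derived-conj n g N) (derived-conj n (g ⁻¹) (normalizer-⁻¹ respects N))

    lowerCentral-⊆ : ∀ n → LowerCentral H n ⊆ H
    lowerCentral-⊆ zero x Hx = lower Hx
    lowerCentral-⊆ (suc n) = commSub-least subH λ a b Aa Bb → comm-closed (lowerCentral-⊆ n a Aa) (lower Bb)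

module Substitution where

  rename : ∀ {n n′} → (Fin n → Fin n′) → Term n → Term n′
  rename r (var i) = var (r i)
  rename r one = one
  rename r (t · u) = rename r t · rename r u
  rename r (inv t) = inv (rename r t)

  substTerm : ∀ {n n′} → (Fin n → Term n′) → Term n → Term n′
  substTerm σ (var i) = σ i
  substTerm σ one = one
  substTerm σ (t · u) = substTerm σ t · substTerm σ u
  substTerm σ (inv t) = inv (substTerm σ t)

  under : ∀ {n n′} → (Fin n → Term n′) → Fin (suc n) → Term (suc n′)
  under σ zero = var zero
  under σ (suc i) = rename suc (σ i)

  subst : ∀ {n n′} → (Fin n → Term n′) → Formula n → Formula n′
  subst σ (t ≐ u) = substTerm σ t ≐ substTerm σ u
  subst σ (neg φ) = neg (subst σ φ)
  subst σ (φ ∧f ψ) = subst σ φ ∧f subst σ ψ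
  subst σ (φ ∨f ψ) = subst σ φ ∨f subst σ ψ
  subst σ (φ ⇒f ψ) = subst σ φ ⇒f subst σ ψ
  subst σ (all φ) = all (subst (under σ) φ)
  subst σ (ex φ) = ex (subst (under σ) φ)

  _▹_ : ∀ {m n} → Term n → (Fin m → Term n) → Fin (suc m) → Term n
  (t ▹ σ) zero = t
  (t ▹ σ) (suc i) = σ i

  instantiate : ∀ {m n} → Formula (suc m) → Term n → (Fin m → Term n) → Formula n
  instantiate φ t σ = subst (t ▹ σ) φ

module SubstitutionSemantics {c ℓ : Level} (X : Group c ℓ) where
  open Group X using (_≈_; _∙_; _⁻¹)
  open GroupNotions X
  open Substitution
  open import Data.Vec.Functional using (_∷_)

  eval-rename : ∀ {n n′} (r : Fin n → Fin n′) t (ρ : Env n′) → eval (rename r t) ρ ≡ eval t (λ i → ρ (r i))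
  eval-rename r (var i) ρ = P.refl
  eval-rename r one ρ = P.refl
  eval-rename r (t · u) ρ = P.cong₂ _∙_ (eval-rename r t ρ) (eval-rename r u ρ)
  eval-rename r (inv t) ρ = P.cong _⁻¹ (eval-rename r t ρ)

  eval-subst : ∀ {n n′} (σ : Fin n → Term n′) t (ρ : Env n′) →
    eval (substTerm σ t) ρ ≡ eval t (λ i → eval (σ i) ρ)
  eval-subst σ (var i) ρ = P.refl
  eval-subst σ one ρ = P.refl
  eval-subst σ (t · u) ρ = P.cong₂ _∙_ (eval-subst σ t ρ) (eval-subst σ u ρ)
  eval-subst σ (inv t) ρ = P.cong _⁻¹ (eval-subst σ t ρ)

  eval-cong : ∀ {n} (t : Term n) {ρ ρ′ : Env n} → (∀ i → ρ i ≡ ρ′ i) → eval t ρ ≡ eval t ρ′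
  eval-cong (var i) ρ≗ρ′ = ρ≗ρ′ i
  eval-cong one ρ≗ρ′ = P.refl
  eval-cong (t · u) ρ≗ρ′ = P.cong₂ _∙_ (eval-cong t ρ≗ρ′) (eval-cong u ρ≗ρ′)
  eval-cong (inv t) ρ≗ρ′ = P.cong _⁻¹ (eval-cong t ρ≗ρ′)

  ∷-cong : ∀ {n} {ρ ρ′ : Env n} x → (∀ i → ρ i ≡ ρ′ i) → ∀ i → (x ∷ ρ) i ≡ (x ∷ ρ′) i
  ∷-cong x ρ≗ρ′ zero = P.refl
  ∷-cong x ρ≗ρ′ (suc i) = ρ≗ρ′ i

  Sat-cong : ∀ {n} (φ : Formula n) {ρ ρ′ : Env n} → (∀ i → ρ i ≡ ρ′ i) → Sat φ ρ → Sat φ ρ′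
  Sat-cong (t ≐ u) ρ≗ρ′ s = lift (P.subst₂ _≈_ (eval-cong t ρ≗ρ′) (eval-cong u ρ≗ρ′) (lower s))
  Sat-cong (neg φ) ρ≗ρ′ s = λ s′ → s (Sat-cong φ (λ i → P.sym (ρ≗ρ′ i)) s′)
  Sat-cong (φ ∧f ψ) ρ≗ρ′ (s , s′) = Sat-cong φ ρ≗ρ′ s , Sat-cong ψ ρ≗ρ′ s′
  Sat-cong (φ ∨f ψ) ρ≗ρ′ (inj₁ s) = inj₁ (Sat-cong φ ρ≗ρ′ s)
  Sat-cong (φ ∨f ψ) ρ≗ρ′ (inj₂ s) = inj₂ (Sat-cong ψ ρ≗ρ′ s)
  Sat-cong (φ ⇒f ψ) ρ≗ρ′ s = λ s′ → Sat-cong ψ ρ≗ρ′ (s (Sat-cong φ (λ i → P.sym (ρ≗ρ′ i)) s′))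
  Sat-cong (all φ) ρ≗ρ′ s = λ x → Sat-cong φ (∷-cong x ρ≗ρ′) (s x)
  Sat-cong (ex φ) ρ≗ρ′ (x , s) = x , Sat-cong φ (∷-cong x ρ≗ρ′) s

  Sat-cong⇔ : ∀ {n} (φ : Formula n) {ρ ρ′ : Env n} → (∀ i → ρ i ≡ ρ′ i) → Sat φ ρ ⇔ Sat φ ρ′
  Sat-cong⇔ φ ρ≗ρ′ = mk⇔ (Sat-cong φ ρ≗ρ′) (Sat-cong φ (λ i → P.sym (ρ≗ρ′ i)))

  Sat-under : ∀ {n n′} (φ : Formula (suc n)) (σ : Fin n → Term n′) (ρ : Env n′) x →
    Sat (subst (under σ) φ) (x ∷ ρ) ⇔ Sat φ (x ∷ (λ i → eval (σ i) ρ))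

  Sat-subst : ∀ {n n′} (φ : Formula n) (σ : Fin n → Term n′) (ρ : Env n′) →
    Sat (subst σ φ) ρ ⇔ Sat φ (λ i → eval (σ i) ρ)
  Sat-subst (t ≐ u) σ ρ = mk⇔
    (λ s → lift (P.subst₂ _≈_ (eval-subst σ t ρ) (eval-subst σ u ρ) (lower s)))
    (λ s → lift (P.subst₂ _≈_ (P.sym (eval-subst σ t ρ)) (P.sym (eval-subst σ u ρ)) (lower s)))
  Sat-subst (neg φ) σ ρ = ¬-cong-⇔ (Sat-subst φ σ ρ)
  Sat-subst (φ ∧f ψ) σ ρ = Sat-subst φ σ ρ ×-⇔ Sat-subst ψ σ ρ
  Sat-subst (φ ∨f ψ) σ ρ = Sat-subst φ σ ρ ⊎-⇔ Sat-subst ψ σ ρ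
  Sat-subst (φ ⇒f ψ) σ ρ = →-cong-⇔ (Sat-subst φ σ ρ) (Sat-subst ψ σ ρ)
  Sat-subst (all φ) σ ρ = mk⇔
    (λ f x → to (Sat-under φ σ ρ x) (f x)) (λ f x → from (Sat-under φ σ ρ x) (f x))
  Sat-subst (ex φ) σ ρ = mk⇔
    (λ (x , s) → x , to (Sat-under φ σ ρ x) s) (λ (x , s) → x , from (Sat-under φ σ ρ x) s)

  Sat-under φ σ ρ x = ⇔-trans (Sat-subst φ (under σ) (x ∷ ρ)) (Sat-cong⇔ φ under-value)
    where
    under-value : ∀ i → eval (under σ i) (x ∷ ρ) ≡ (x ∷ (λ j → eval (σ j) ρ)) i
    under-value zero = P.refl
    under-value (suc i) = eval-rename suc (σ i) (x ∷ ρ)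

  Sat-instantiate : ∀ {m n} (φ : Formula (suc m)) (t : Term n) (σ : Fin m → Term n) (ρ : Env n) →
    Sat (instantiate φ t σ) ρ ⇔ Defined φ (λ i → eval (σ i) ρ) (eval t ρ)
  Sat-instantiate φ t σ ρ = ⇔-trans (Sat-subst φ (t ▹ σ) ρ) (Sat-cong⇔ φ ▹-value)
    where
    ▹-value : ∀ i → eval ((t ▹ σ) i) ρ ≡ (eval t ρ ∷ (λ i → eval (σ i) ρ)) i
    ▹-value zero = P.refl
    ▹-value (suc i) = P.refl

-- The formulas used in the construction.  Parameters are always listed
-- after the free variable x.
module Formulas where
  open Substitution

  _∧ₚ_ : ∀ {m₁ m₂} → Formula (suc m₁) → Formula (suc m₂) → Formula (suc (m₁ + m₂))
  _∧ₚ_ {m₁} {m₂} φ ψ =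
    instantiate φ (var zero) (λ i → var (suc (i ↑ˡ m₂)))
      ∧f instantiate ψ (var zero) (λ i → var (suc (m₁ ↑ʳ i)))

  -- number of parameters of k + 1 copies of a formula with m parameters
  copies : ℕ → ℕ → ℕ
  copies zero m = m
  copies (suc k) m = copies k m + m

  ⋀ : ∀ {m} k → Formula (suc m) → Formula (suc (copies k m))
  ⋀ zero ψ = ψ
  ⋀ (suc k) ψ = ⋀ k ψ ∧ₚ ψ

  trivialF : Formula (suc 0)
  trivialF = var zero ≐ one

  trueF : Formula (suc 0)
  trueF = var zero ≐ var zero

  v₀ v₁ : ∀ {m} → Term (suc (suc m))
  v₀ = var zero
  v₁ = var (suc zero)

  params : ∀ {m} → Fin m → Term (suc (suc m))
  params i = var (suc (suc i))

  conjT commT : ∀ {m} → Term (suc (suc m))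
  conjT = (v₁ · v₀) · inv v₁
  commT = ((inv v₀ · inv v₁) · v₀) · v₁

  -- x normalises ζ(X, ā):  ∀ y (ζ(y, ā) ↔ ζ(x y x⁻¹, ā)), with y bound as v₀ and x shifted to v₁
  normalizerF : ∀ {m} → Formula (suc m) → Formula (suc m)
  normalizerF ζ = all ((instantiate ζ v₀ params ⇒f instantiate ζ conjT params)
                    ∧f (instantiate ζ conjT params ⇒f instantiate ζ v₀ params))

  centMod₁F : ∀ {m} → Formula (suc m) → Formula (suc (suc m))
  centMod₁F ζ = instantiate (normalizerF ζ) v₀ params ∧f instantiate ζ commT params

module FormulaSemantics {c ℓ : Level} (X : Group c ℓ) where
  open GroupNotions X
  open GroupTheory X using (_≅_; Trivial; CentMod₁)
  open Substitution
  open SubstitutionSemantics X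
  open Formulas
  open import Data.Vec.Functional using (_∷_; _++_)
  open import Data.Vec.Functional.Properties using (lookup-++ˡ; lookup-++ʳ)

  trivialF-sat : ∀ h → Trivial h ≅ Defined trivialF (λ ())
  trivialF-sat h = (λ _ x≈ε → lift (lower x≈ε)) , (λ _ x≈ε → lift (lower x≈ε))

  ∧ₚ-sat : ∀ {m₁ m₂} (φ : Formula (suc m₁)) (ψ : Formula (suc m₂)) a₁ a₂ x →
    Defined (φ ∧ₚ ψ) (a₁ ++ a₂) x ⇔ (Defined φ a₁ x × Defined ψ a₂ x)
  ∧ₚ-sat {m₁} {m₂} φ ψ a₁ a₂ x = left ×-⇔ right
    where
    left = ⇔-trans (Sat-instantiate φ (var zero) (λ i → var (suc (i ↑ˡ m₂))) (x ∷ (a₁ ++ a₂)))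
                   (Sat-cong⇔ φ (∷-cong x (lookup-++ˡ a₁ a₂)))
    right = ⇔-trans (Sat-instantiate ψ (var zero) (λ i → var (suc (m₁ ↑ʳ i))) (x ∷ (a₁ ++ a₂)))
                    (Sat-cong⇔ ψ (∷-cong x (lookup-++ʳ a₁ a₂)))

  ∩-≅-∧ₚ : ∀ {m₁ m₂ a b} {A : Subset a} {B : Subset b} (φ : Formula (suc m₁)) (ψ : Formula (suc m₂)) a₁ a₂ →
    A ≅ Defined φ a₁ → B ≅ Defined ψ a₂ → (A ∩ B) ≅ Defined (φ ∧ₚ ψ) (a₁ ++ a₂)
  ∩-≅-∧ₚ φ ψ a₁ a₂ (A⊆φ , φ⊆A) (B⊆ψ , ψ⊆B) =
    (λ x (x∈A , x∈B) → from (∧ₚ-sat φ ψ a₁ a₂ x) (A⊆φ x x∈A , B⊆ψ x x∈B)) ,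
    (λ x x∈φ∧ψ → let (x∈φ , x∈ψ) = to (∧ₚ-sat φ ψ a₁ a₂ x) x∈φ∧ψ in φ⊆A x x∈φ , ψ⊆B x x∈ψ)

  concatParams : ∀ {m} k → (ℕ → Env m) → Env (copies k m)
  concatParams zero p = p 0
  concatParams (suc k) p = concatParams k p ++ p (suc k)

  ⋀-sat : ∀ {m} k (ψ : Formula (suc m)) p x →
    Defined (⋀ k ψ) (concatParams k p) x ⇔ (∀ j → j ≤ k → Defined ψ (p j) x)
  ⋀-sat zero ψ p x = mk⇔ (λ { s zero z≤n → s }) (λ f → f 0 z≤n)
  ⋀-sat (suc k) ψ p x = mk⇔
    (λ s j j≤k+1 → [ (λ j<k+1 → to (⋀-sat k ψ p x) (proj₁ (split s)) j (m<1+n⇒m≤n j<k+1))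
                   , (λ { P.refl → proj₂ (split s) }) ]′ (m≤n⇒m<n∨m≡n j≤k+1))
    (λ f → from (∧ₚ-sat (⋀ k ψ) ψ (concatParams k p) (p (suc k)) x)
             (from (⋀-sat k ψ p x) (λ j j≤k → f j (m≤n⇒m≤1+n j≤k)) , f (suc k) ≤-refl))
    where split = to (∧ₚ-sat (⋀ k ψ) ψ (concatParams k p) (p (suc k)) x)

  normalizerF-sat : ∀ {m} (ζ : Formula (suc m)) a x →
    Defined (normalizerF ζ) a x ⇔ Normalizer (Defined ζ a) x
  normalizerF-sat ζ a x = mk⇔ (λ f y → to (at y) (f y)) (λ f y → from (at y) (f y))
    where
    itself = λ y → Sat-instantiate ζ v₀ params (y ∷ x ∷ a)
    conjugate = λ y → Sat-instantiate ζ conjT params (y ∷ x ∷ a)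
    at = λ y → →-cong-⇔ (itself y) (conjugate y) ×-⇔ →-cong-⇔ (conjugate y) (itself y)

  centMod₁F-sat : ∀ {m} (ζ : Formula (suc m)) s a x →
    Defined (centMod₁F ζ) (s ∷ a) x ⇔ CentMod₁ (Defined ζ a) s x
  centMod₁F-sat ζ s a x = ⇔-trans normalizing (normalizerF-sat ζ a x) ×-⇔ commutator
    where
    normalizing = Sat-instantiate (normalizerF ζ) v₀ params (x ∷ s ∷ a)
    commutator = Sat-instantiate ζ commT params (x ∷ s ∷ a)

-- In an icc-group, an arbitrary intersection ⋂_{ā ∈ A} ψ(X, ā) of subgroups
-- defined by ψ is already the intersection of K + 1 of them, where K
-- depends only on ψ.  Otherwise one could keep adding a parameter that
-- cuts the intersection down, producing a strictly descending chain longer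
-- than the icc bound for ψ.
module FiniteIntersection (lem : ExcludedMiddle) {c ℓ : Level} (X : Group c ℓ)
    (icc : GroupNotions.IsIcc X) {m : ℕ} (ψ : Formula (suc m)) where
  open Group X using (Carrier)
  open GroupNotions X
  open GroupTheory X using (_≅_)

  N K : ℕ
  N = proj₁ (icc ψ)
  K = suc N

  Prefix : (ℕ → Env m) → ℕ → Subset (c ⊔ ℓ)
  Prefix p n x = ∀ j → j ≤ n → Defined ψ (p j) x

  module _ (A : Env m → Set (c ⊔ ℓ)) (subgroups : ∀ a → A a → IsSubgroup (Defined ψ a))
           (a₀ : Env m) (a₀∈A : A a₀) where

    Sufficient : Set (c ⊔ ℓ)
    Sufficient = Σ (ℕ → Env m) λ p → (∀ j → A (p j)) × (Prefix p K ⊆ ⋂Defined ψ A)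

    Escape : (ℕ → Env m) → Set (c ⊔ ℓ)
    Escape p = Σ Carrier λ x → Σ (Env m) λ a → A a × Prefix p K x × ¬ Defined ψ a x

    escape : ¬ Sufficient → (p : ℕ → Env m) → (∀ j → A (p j)) → Escape p
    escape insufficient p p∈A = decidable-stable (lem (Escape p)) λ noEscape →
      insufficient (p , p∈A , λ x x∈P a a∈A →
        decidable-stable (lem (Defined ψ a x)) λ x∉ψa → noEscape (x , a , a∈A , x∈P , x∉ψa))

    extend : (ℕ → Env m) → ℕ → Env m → ℕ → Env m
    extend p i a j with j ≤? i
    ... | yes _ = p j
    ... | no _ = a

    extend-≤ : ∀ p i a j → j ≤ i → extend p i a j ≡ p j
    extend-≤ p i a j j≤i with j ≤? i
    ... | yes _ = P.refl
    ... | no j≰i = ⊥-elim (j≰i j≤i)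

    extend-> : ∀ p i a j → i < j → extend p i a j ≡ a
    extend-> p i a j i<j with j ≤? i
    ... | yes j≤i = ⊥-elim (<⇒≱ i<j j≤i)
    ... | no _ = P.refl

    extend-all : ∀ p i a → (∀ j → A (p j)) → A a → ∀ j → A (extend p i a j)
    extend-all p i a p∈A a∈A j with j ≤? i
    ... | yes _ = p∈A j
    ... | no _ = a∈A

    module Chain (insufficient : ¬ Sufficient) where
      Stage : Set (c ⊔ ℓ)
      Stage = Σ (ℕ → Env m) λ p → ∀ j → A (p j)

      escape-at : (s : Stage) → Escape (proj₁ s)
      escape-at s = escape insufficient (proj₁ s) (proj₂ s)

      -- stage i lists the chosen parameters p 0, …, p i and then repeats p i;
      -- stage i + 1 appends a parameter cutting down the intersection of stage i
      stage : ℕ → Stage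
      stage zero = (λ _ → a₀) , (λ _ → a₀∈A)
      stage (suc i) = let (p , p∈A) = stage i ; (_ , a , a∈A , _) = escape-at (stage i) in
        extend p i a , extend-all p i a p∈A a∈A

      params : ℕ → ℕ → Env m
      params i = proj₁ (stage i)

      cut : ℕ → Env m
      cut i = proj₁ (proj₂ (escape-at (stage i)))

      params-stable : ∀ i j → i ≤ j → params i j ≡ params i i
      params-stable zero j _ = P.refl
      params-stable (suc i) j i<j = P.trans (extend-> (params i) i (cut i) j i<j)
                                            (P.sym (extend-> (params i) i (cut i) (suc i) ≤-refl))

      -- stage i + 1 agrees with stage i up to position i, and later entries
      -- of stage i equal its entry i
      descending : ∀ i → i ≤ N → Prefix (params (suc i)) K ⊆ Prefix (params i) K
      descending i i≤N x x∈P j j≤K with j ≤? i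
      ... | yes j≤i = P.subst (λ a → Defined ψ a x) (extend-≤ (params i) i (cut i) j j≤i) (x∈P j j≤K)
      ... | no j≰i = P.subst (λ a → Defined ψ a x)
              (P.trans (extend-≤ (params i) i (cut i) i ≤-refl) (P.sym (params-stable i j (<⇒≤ (≰⇒> j≰i)))))
              (x∈P i (m≤n⇒m≤1+n i≤N))

      -- the escaping element of stage i lies outside the new parameter's subgroup
      strictly : ∀ i → i ≤ N → ¬ (Prefix (params i) K ⊆ Prefix (params (suc i)) K)
      strictly i i≤N ⊆next = let (x , _ , _ , x∈P , x∉ψcut) = escape-at (stage i) in
        x∉ψcut (P.subst (λ a → Defined ψ a x) (extend-> (params i) i (cut i) (suc i) ≤-refl)
                  (⊆next x x∈P (suc i) (s≤s i≤N)))

      -- the stages as sets of parameters, to which the icc bound applies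
      C : ℕ → Env m → Set (c ⊔ ℓ)
      C i a = Lift (c ⊔ ℓ) (Σ ℕ λ j → j ≤ K × a ≡ params i j)

      C-prefix : ∀ i → ⋂Defined ψ (C i) ≅ Prefix (params i) K
      C-prefix i = (λ x x∈⋂ j j≤K → x∈⋂ (params i j) (lift (j , j≤K , P.refl)))
                 , (λ { x x∈P _ (lift (j , j≤K , P.refl)) → x∈P j j≤K })

      chain-too-long : ⊥
      chain-too-long = 1+n≰n (proj₂ (icc ψ) K C
        (λ { i _ _ (lift (j , _ , P.refl)) → subgroups _ (proj₂ (stage i) j) })
        (λ { i (s≤s i≤N) →
          (λ x x∈ → from⋂ i x (descending i i≤N x (to⋂ (suc i) x x∈)))
          , (λ ⊇ → strictly i i≤N (λ x x∈P → to⋂ (suc i) x (⊇ x (from⋂ i x x∈P)))) }))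
        where
        to⋂ = λ i → proj₁ (C-prefix i)
        from⋂ = λ i → proj₂ (C-prefix i)

    finite-intersection : Sufficient
    finite-intersection = decidable-stable (lem Sufficient) Chain.chain-too-long

-- In an icc-group, centralisers modulo a uniformly definable subgroup are
-- uniformly definable: if Z = ζ(X, ā) is a subgroup and 1 ∈ S, then
-- CentMod Z S = ⋂_{s ∈ S} CentMod₁ Z s is the intersection of finitely many
-- sets defined by centMod₁F ζ, and the number of them depends only on ζ.
module DefinableCentralisers (lem : ExcludedMiddle) {c ℓ : Level} (X : Group c ℓ)
    (icc : GroupNotions.IsIcc X) where
  open Group X using (Carrier; ε)
  open GroupNotions X
  open GroupTheory X
  open Formulas
  open FormulaSemantics X
  open import Data.Vec.Functional using (_∷_)

  -- with excluded middle every proposition is equivalent to one in Set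
  Resized : ∀ {b} → Set b → Set
  Resized P = True (lem P)

  centModBound : ∀ {m} → Formula (suc m) → ℕ
  centModBound ζ = FiniteIntersection.K lem X icc (centMod₁F ζ)

  centModArity : ∀ {m} → Formula (suc m) → ℕ
  centModArity {m} ζ = copies (centModBound ζ) (suc m)

  centModF : ∀ {m} (ζ : Formula (suc m)) → Formula (suc (centModArity ζ))
  centModF ζ = ⋀ (centModBound ζ) (centMod₁F ζ)

  centMod-definable : ∀ {m} (ζ : Formula (suc m)) (a : Env m) {z b} {Z : Subset z} {S : Subset b} →
    Z ≅ Defined ζ a → IsSubgroup Z → S ε →
    Σ (Env (centModArity ζ)) λ q → CentMod Z S ≅ Defined (centModF ζ) q
  centMod-definable {m} ζ a {Z = Z} {S} Z≅ζ subZ ε∈S = concatParams K p , centMod⊆ , ⊆centMod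
    where
    open CentModProperties subZ
    open FiniteIntersection lem X icc (centMod₁F ζ)

    centMod₁-≅ : ∀ s → CentMod₁ Z s ≅ Defined (centMod₁F ζ) (s ∷ a)
    centMod₁-≅ s =
      (λ x (Nx , Z[x,s]) → from (centMod₁F-sat ζ s a x) (normalizer-≅ Z≅ζ x Nx , proj₁ Z≅ζ _ Z[x,s])) ,
      (λ x d → let (Nx , ζ[x,s]) = to (centMod₁F-sat ζ s a x) d in
        normalizer-≅ (≅-sym Z≅ζ) x Nx , proj₂ Z≅ζ _ ζ[x,s])

    Params : Env (suc m) → Set (c ⊔ ℓ)
    Params q = Lift (c ⊔ ℓ) (Σ Carrier λ s → Resized (S s) × q ≡ s ∷ a)

    s-params : ∀ {s} → S s → Params (s ∷ a)
    s-params s∈S = lift (_ , fromWitness s∈S , P.refl)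

    centMod₁-subgroups : ∀ q → Params q → IsSubgroup (Defined (centMod₁F ζ) q)
    centMod₁-subgroups _ (lift (s , _ , P.refl)) = subgroup-≅ (centMod₁-≅ s) (centMod₁-subgroup s)

    sufficient : Sufficient Params centMod₁-subgroups (ε ∷ a) (s-params ε∈S)
    sufficient = finite-intersection Params centMod₁-subgroups (ε ∷ a) (s-params ε∈S)

    p : ℕ → Env (suc m)
    p = proj₁ sufficient

    centMod⊆ : CentMod Z S ⊆ Defined (centModF ζ) (concatParams K p)
    centMod⊆ x (Nx , commutes) = from (⋀-sat K (centMod₁F ζ) p x) λ j _ →
      let (lift (s , s∈S , pj≡s∷a)) = proj₁ (proj₂ sufficient) j in
      P.subst (λ q → Defined (centMod₁F ζ) q x) (P.sym pj≡s∷a)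
        (proj₁ (centMod₁-≅ s) x (Nx , commutes s (toWitness s∈S)))

    ⊆centMod : Defined (centModF ζ) (concatParams K p) ⊆ CentMod Z S
    ⊆centMod x d = proj₁ (in-centMod₁ (s-params ε∈S)) , λ s s∈S → proj₂ (in-centMod₁ (s-params s∈S))
      where
      in-all : ⋂Defined (centMod₁F ζ) Params x
      in-all = proj₂ (proj₂ sufficient) x (to (⋀-sat K (centMod₁F ζ) p x) d)

      in-centMod₁ : ∀ {s} → Params (s ∷ a) → CentMod₁ Z s x
      in-centMod₁ {s} q∈Params = proj₂ (centMod₁-≅ s) x (in-all (s ∷ a) q∈Params)

  -- The formulas obtained by iterating centModF from x = 1; the n-th one
  -- defines every n-fold iterated centraliser CentMod (… (CentMod 1 S₀) …) Sₙ₋₁.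
  towerArity : ℕ → ℕ
  towerF : (n : ℕ) → Formula (suc (towerArity n))

  towerArity zero = 0
  towerArity (suc n) = centModArity (towerF n)

  towerF zero = trivialF
  towerF (suc n) = centModF (towerF n)

-- Both parts of the theorem
-- follow from an envelope when F is monotone.
module Envelopes {c ℓ : Level} (X : Group c ℓ) where
  open GroupNotions X

  Series : Setω
  Series = ∀ {a} → Subset a → ℕ → Subset (c ⊔ ℓ ⊔ a)

  Monotone : Series → Setω
  Monotone F = ∀ {a b} {A : Subset a} {B : Subset b} → A ⊆ B → ∀ n → F A n ⊆ F B n

  HasLength : ∀ {a} → Series → Subset a → ℕ → Set (c ⊔ ℓ ⊔ a)
  HasLength F A d = IsTrivial (F A d) × (∀ k → k < d → ¬ IsTrivial (F A k))

  Envelope : (h : Level) → Series → ℕ → Set (c ⊔ ℓ ⊔ Level.suc h)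
  Envelope h F d = Σ ℕ λ m → Σ (Formula (suc m)) λ φ →
    (H : Subset h) → IsSubgroup H → IsTrivial (F H d) →
    Σ (Env m) λ a →
      IsSubgroup (Defined φ a) × (H ⊆ Defined φ a) × IsTrivial (F (Defined φ a) d) ×
      (Normalizer H ⊆ Normalizer (Defined φ a))

  length-squeeze : ∀ {h a b} (F : Series) → Monotone F → ∀ {d} {H : Subset h} {A : Subset a} {B : Subset b} →
    H ⊆ A → A ⊆ B → HasLength F H d → IsTrivial (F B d) → HasLength F A d
  length-squeeze F mono {d} H⊆A A⊆B (_ , H-long) FBd-trivial =
    (λ x FAx → FBd-trivial x (mono A⊆B d x FAx)) ,
    (λ k k<d FAk-trivial → H-long k k<d (λ x FHx → FAk-trivial x (mono H⊆A k x FHx)))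

  envelope-exact : ∀ {h} (F : Series) → Monotone F → ∀ {d} → Envelope h F d →
    Σ ℕ λ m → Σ (Formula (suc m)) λ φ →
    (H : Subset h) → IsSubgroup H → HasLength F H d →
    Σ (Env m) λ a →
      IsSubgroup (Defined φ a) × (H ⊆ Defined φ a) × HasLength F (Defined φ a) d ×
      (Normalizer H ⊆ Normalizer (Defined φ a))
  envelope-exact F mono (m , φ , envelope) = m , φ , λ H subH H-length →
    let (a , subD , H⊆D , FDd-trivial , N⊆N) = envelope H subH (proj₁ H-length) in
    a , subD , H⊆D , length-squeeze F mono H⊆D (λ _ x∈D → x∈D) H-length FDd-trivial , N⊆N

  envelope-relative : ∀ {h g} (F : Series) → Monotone F → ∀ {d} → Envelope h F d →
    (G : Subset g) → IsSubgroup G →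
    Σ ℕ λ m → Σ (Formula (suc m)) λ φ →
    (H : Subset h) → IsSubgroup H → H ⊆ G → HasLength F H d →
    Σ (Env m) λ a →
      IsSubgroup (Defined φ a) × (H ⊆ (Defined φ a ∩ G)) × HasLength F (Defined φ a ∩ G) d ×
      ((Normalizer H ∩ G) ⊆ (Normalizer (Defined φ a ∩ G) ∩ G))
  envelope-relative F mono (m , φ , envelope) G subG = m , φ , λ H subH H⊆G H-length →
    let (a , subD , H⊆D , FDd-trivial , N⊆N) = envelope H subH (proj₁ H-length)
        H⊆D∩G = λ x x∈H → H⊆D x x∈H , H⊆G x x∈H in
    a , subD , H⊆D∩G , length-squeeze F mono H⊆D∩G (λ _ → proj₁) H-length FDd-trivial ,
    λ x (x∈NH , x∈G) → GroupTheory.∩-normalizer X x (N⊆N x x∈NH , ⊆-normalizer x x∈G) , x∈G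
    where open GroupTheory.SubgroupProperties X subG

-- Fix H with
-- H⁽ᵈ⁾ = 1 and put, for all n and k,
--   T₀ₖ = 1,   Eₙₖ = CentMod Tₙ₍ₖ₊₁₎ H⁽ᵏ⁾,   Tₙ₊₁,ₖ = CentMod Tₙ₍ₖ₊₁₎ Eₙₖ.
-- If H⁽ᵏ⁺ⁿ⁾ = 1 then H⁽ᵏ⁾ ≤ Tₙₖ and Tₙₖ is soluble of length ≤ n; each Tₙₖ is
-- normalised by N(H) and defined by towerF n.
-- The envelope is D = T_d0.
module SolubleEnvelope (lem : ExcludedMiddle) {c ℓ : Level} (X : Group c ℓ)
    (icc : GroupNotions.IsIcc X) where
  open Group X using () renaming (refl to ≈-refl)
  open GroupNotions X
  open GroupTheory X
  open FormulaSemantics X using (trivialF-sat)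
  open DefinableCentralisers lem X icc
  open Envelopes X

  module Construction {h} (H : Subset h) (subH : IsSubgroup H) where
    open SubgroupProperties subH using (⊆-normalizer)
    open SeriesProperties subH

    T E : ℕ → ℕ → Subset (c ⊔ ℓ ⊔ h)
    T zero k = Trivial h
    T (suc n) k = CentMod (T n (suc k)) (E n k)
    E n k = CentMod (T n (suc k)) (Derived H k)

    T-subgroup : ∀ n k → IsSubgroup (T n k)
    T-subgroup zero k = trivial-subgroup h
    T-subgroup (suc n) k = CentModProperties.centMod-subgroup (T-subgroup n (suc k)) (E n k)

    E-subgroup : ∀ n k → IsSubgroup (E n k)
    E-subgroup n k = CentModProperties.centMod-subgroup (T-subgroup n (suc k)) (Derived H k)

    T-normalizer : ∀ n k → Normalizer H ⊆ Normalizer (T n k)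
    T-normalizer zero k g _ = trivial-normal h g
    T-normalizer (suc n) k g g∈NH =
      centMod-normalizer (IsSubgroup.respects (E-subgroup n k)) g (g∈NT , centMod-normalizer
        (derived-respects k) g (g∈NT , derived-normalizer k g g∈NH))
      where
      open CentModProperties (T-subgroup n (suc k))
      g∈NT = T-normalizer n (suc k) g g∈NH

    T-definable : ∀ n k → Σ (Env (towerArity n)) λ a → T n k ≅ Defined (towerF n) a
    T-definable zero k = (λ ()) , trivialF-sat h
    T-definable (suc n) k = let (a , T≅φ) = T-definable n (suc k) in
      centMod-definable (towerF n) a T≅φ (T-subgroup n (suc k)) (IsSubgroup.has-ε (E-subgroup n k))

    Solved : ℕ → Set (c ⊔ ℓ ⊔ h)
    Solved n = IsTrivial (Derived H n)

    private
      shift : ∀ k n → Solved (k + suc n) → Solved (suc k + n)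
      shift k n = P.subst Solved (+-suc k n)

      derived-normalizes : ∀ n j k → Derived H k ⊆ Normalizer (T n j)
      derived-normalizes n j k x x∈H⁽ᵏ⁾ = T-normalizer n j x (⊆-normalizer x (derived-⊆ k x x∈H⁽ᵏ⁾))

    -- H⁽ᵏ⁾ ≤ Tₙₖ: it normalises Tₙ₍ₖ₊₁₎, and Eₙₖ centralises it modulo Tₙ₍ₖ₊₁₎ by definition
    derived-⊆-T : ∀ n k → Solved (k + n) → Derived H k ⊆ T n k
    derived-⊆-T zero k solved x x∈H⁽ᵏ⁾ =
      lift (solved x (P.subst (λ i → Derived H i x) (P.sym (+-identityʳ k)) x∈H⁽ᵏ⁾))
    derived-⊆-T (suc n) k solved x x∈H⁽ᵏ⁾ = derived-normalizes n (suc k) k x x∈H⁽ᵏ⁾ , λ e e∈E →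
      SubgroupProperties.comm-swap (T-subgroup n (suc k)) (proj₂ e∈E x x∈H⁽ᵏ⁾)

    -- H⁽ᵏ⁾ centralises itself modulo H⁽ᵏ⁺¹⁾ ≤ Tₙ₍ₖ₊₁₎
    derived-⊆-E : ∀ n k → Solved (k + suc n) → Derived H k ⊆ E n k
    derived-⊆-E n k solved x x∈H⁽ᵏ⁾ = derived-normalizes n (suc k) k x x∈H⁽ᵏ⁾ , λ y y∈H⁽ᵏ⁾ →
      derived-⊆-T n (suc k) (shift k n solved) _ (gen (x , y , x∈H⁽ᵏ⁾ , y∈H⁽ᵏ⁾ , ≈-refl))

    -- Tₙ₊₁,ₖ ≤ Eₙₖ, so Tₙ₊₁,ₖ is abelian modulo Tₙ₍ₖ₊₁₎
    T-commutators : ∀ n k → Solved (k + suc n) → ∀ x y → T (suc n) k x → T (suc n) k y → T n (suc k) [ x , y ]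
    T-commutators n k solved x y (_ , x-centralises) (y∈NT , y-centralises) =
      x-centralises y (y∈NT , λ z z∈H⁽ᵏ⁾ → y-centralises z (derived-⊆-E n k solved z z∈H⁽ᵏ⁾))

    -- (Tₙₖ)⁽ⁿ⁾ = 1, by induction on n using (Tₙ₊₁,ₖ)′ ≤ Tₙ₍ₖ₊₁₎
    T-soluble : ∀ n k → Solved (k + n) → IsTrivial (Derived (T n k) n)
    T-soluble zero k solved x x∈T = lower (lower x∈T)
    T-soluble (suc n) k solved x x∈T⁽ⁿ⁺¹⁾ = T-soluble n (suc k) (shift k n solved) x
      (derived-mono (commSub-least (T-subgroup n (suc k)) λ a b a∈T b∈T →
          T-commutators n k solved a b (lower a∈T) (lower b∈T)) n x
        (derived-shift n x x∈T⁽ⁿ⁺¹⁾))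

  soluble-envelope : ∀ {h} d → Envelope h Derived d
  soluble-envelope d = towerArity d , towerF d , λ H subH solved →
    let open Construction H subH
        (a , T≅φ) = T-definable d 0
        H⊆D = λ x x∈H → proj₁ T≅φ x (derived-⊆-T d 0 solved x (lift x∈H)) in
    a , subgroup-≅ T≅φ (T-subgroup d 0) , H⊆D ,
    (λ x x∈D⁽ᵈ⁾ → T-soluble d 0 solved x (derived-mono (proj₂ T≅φ) d x x∈D⁽ᵈ⁾)) ,
    (λ g g∈NH → normalizer-≅ T≅φ g (T-normalizer d 0 g g∈NH))

-- Fix H with γ_d(H) = 1 (lower central series indexed
-- from γ₀ = H) and let
--   Z₀ = 1,   Zᵢ₊₁ = CentMod Zᵢ H,   Cᵢ = CentMod Zᵢ Zᵢ₊₁,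
-- the upper central series of H relative to X and its centralisers.  Then
-- γₖ(H) ≤ Z_{d-k}, so H ≤ Z_d, and D = Z_d ∩ ⋂_{i<d} Cᵢ has γ_d(D) = 1,
-- since [Zᵢ₊₁, D] ≤ Zᵢ.  Zᵢ is defined by towerF i and Cᵢ by towerF (i + 1).
module NilpotentEnvelope (lem : ExcludedMiddle) {c ℓ : Level} (X : Group c ℓ)
    (icc : GroupNotions.IsIcc X) where
  open Group X using () renaming (refl to ≈-refl)
  open GroupNotions X
  open GroupTheory X
  open Formulas
  open FormulaSemantics X using (trivialF-sat; ∩-≅-∧ₚ)
  open DefinableCentralisers lem X icc
  open Envelopes X
  open import Data.Vec.Functional using (_++_)

  centralisersArity : ℕ → ℕ
  centralisersArity zero = 0
  centralisersArity (suc n) = centralisersArity n + towerArity (suc n)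

  centralisersF : (n : ℕ) → Formula (suc (centralisersArity n))
  centralisersF zero = trueF
  centralisersF (suc n) = centralisersF n ∧ₚ towerF (suc n)

  module Construction {h} (H : Subset h) (subH : IsSubgroup H) where
    open IsSubgroup subH using () renaming (respects to H-respects)
    open SubgroupProperties subH using (⊆-normalizer)
    open SeriesProperties subH using (lowerCentral-⊆)

    Z : ℕ → Subset (c ⊔ ℓ ⊔ h)
    Z zero = Trivial h
    Z (suc i) = CentMod (Z i) H

    Z-subgroup : ∀ i → IsSubgroup (Z i)
    Z-subgroup zero = trivial-subgroup h
    Z-subgroup (suc i) = CentModProperties.centMod-subgroup (Z-subgroup i) H

    Z-normalizer : ∀ i → Normalizer H ⊆ Normalizer (Z i)
    Z-normalizer zero g _ = trivial-normal h g
    Z-normalizer (suc i) g g∈NH =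
      CentModProperties.centMod-normalizer (Z-subgroup i) H-respects g (Z-normalizer i g g∈NH , g∈NH)

    H-normalizes : ∀ i → H ⊆ Normalizer (Z i)
    H-normalizes i x x∈H = Z-normalizer i x (⊆-normalizer x x∈H)

    Z-definable : ∀ i → Σ (Env (towerArity i)) λ a → Z i ≅ Defined (towerF i) a
    Z-definable zero = (λ ()) , trivialF-sat h
    Z-definable (suc i) = let (a , Z≅φ) = Z-definable i in
      centMod-definable (towerF i) a Z≅φ (Z-subgroup i) (IsSubgroup.has-ε subH)

    C : ℕ → Subset (c ⊔ ℓ ⊔ h)
    C i = CentMod (Z i) (Z (suc i))

    C-subgroup : ∀ i → IsSubgroup (C i)
    C-subgroup i = CentModProperties.centMod-subgroup (Z-subgroup i) (Z (suc i))

    C-normalizer : ∀ i → Normalizer H ⊆ Normalizer (C i)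
    C-normalizer i g g∈NH = CentModProperties.centMod-normalizer (Z-subgroup i)
      (IsSubgroup.respects (Z-subgroup (suc i))) g (Z-normalizer i g g∈NH , Z-normalizer (suc i) g g∈NH)

    C-definable : ∀ i → Σ (Env (towerArity (suc i))) λ a → C i ≅ Defined (towerF (suc i)) a
    C-definable i = let (a , Z≅φ) = Z-definable i in
      centMod-definable (towerF i) a Z≅φ (Z-subgroup i) (IsSubgroup.has-ε (Z-subgroup (suc i)))

    W : ℕ → Subset (c ⊔ ℓ ⊔ h)
    W n x = ∀ i → i < n → C i x

    W-subgroup : ∀ n → IsSubgroup (W n)
    W-subgroup n = record
      { respects = λ x≈y x∈W i i<n → C.respects i x≈y (x∈W i i<n)
      ; has-ε = λ i i<n → C.has-ε i
      ; closed-∙ = λ x∈W y∈W i i<n → C.closed-∙ i (x∈W i i<n) (y∈W i i<n)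
      ; closed-⁻¹ = λ x∈W i i<n → C.closed-⁻¹ i (x∈W i i<n)
      }
      where module C i = IsSubgroup (C-subgroup i)

    W-normalizer : ∀ n → Normalizer H ⊆ Normalizer (W n)
    W-normalizer n g g∈NH x =
      (λ x∈W i i<n → proj₁ (C-normalizer i g g∈NH x) (x∈W i i<n)) ,
      (λ x∈W i i<n → proj₂ (C-normalizer i g g∈NH x) (x∈W i i<n))

    W-definable : ∀ n → Σ (Env (centralisersArity n)) λ a → W n ≅ Defined (centralisersF n) a
    W-definable zero = (λ ()) , (λ _ _ → lift ≈-refl) , (λ _ _ i ())
    W-definable (suc n) = let (a , W≅φ) = W-definable n ; (b , C≅ψ) = C-definable n
                              (W∩C⊆φ∧ψ , φ∧ψ⊆W∩C) = ∩-≅-∧ₚ (centralisersF n) (towerF (suc n)) a b W≅φ C≅ψ in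
      a ++ b ,
      (λ x x∈W → W∩C⊆φ∧ψ x ((λ i i<n → x∈W i (m≤n⇒m≤1+n i<n)) , x∈W n ≤-refl)) ,
      (λ x d → let (x∈W , x∈C) = φ∧ψ⊆W∩C x d in
        λ i i<n+1 → [ (λ i<n → x∈W i i<n) , (λ { P.refl → x∈C }) ]′ (m<1+n⇒m<n∨m≡n i<n+1))

    Nilpotent : ℕ → Set (c ⊔ ℓ ⊔ h)
    Nilpotent n = IsTrivial (LowerCentral H n)

    -- γₖ(H) ≤ Zₙ when γₖ₊ₙ(H) = 1, since [γₖ(H), H] = γₖ₊₁(H)
    lowerCentral-⊆-Z : ∀ n k → Nilpotent (k + n) → LowerCentral H k ⊆ Z n
    lowerCentral-⊆-Z zero k nilpotent x x∈γₖ =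
      lift (nilpotent x (P.subst (λ i → LowerCentral H i x) (P.sym (+-identityʳ k)) x∈γₖ))
    lowerCentral-⊆-Z (suc n) k nilpotent x x∈γₖ = H-normalizes n x (lowerCentral-⊆ k x x∈γₖ) , λ y y∈H →
      lowerCentral-⊆-Z n (suc k) (P.subst Nilpotent (+-suc k n) nilpotent) _ (gen (x , y , x∈γₖ , lift y∈H , ≈-refl))

    module _ (d : ℕ) (nilpotent : Nilpotent d) where
      D : Subset (c ⊔ ℓ ⊔ h)
      D = Z d ∩ W d

      H⊆D : H ⊆ D
      H⊆D x x∈H = lowerCentral-⊆-Z d 0 nilpotent x (lift x∈H) , λ i _ → H-normalizes i x x∈H , λ z z∈Z →
        SubgroupProperties.comm-swap (Z-subgroup i) (proj₂ z∈Z x x∈H)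

      -- γₖ(D) ≤ Zᵢ when i + k = d, since D ≤ Cᵢ gives [Zᵢ₊₁, D] ≤ Zᵢ
      lowerCentral-D : ∀ k i → i + k ≡ d → LowerCentral D k ⊆ Z i
      lowerCentral-D zero i i+0≡d x x∈D =
        P.subst (λ j → Z j x) (P.trans (P.sym i+0≡d) (+-identityʳ i)) (proj₁ (lower x∈D))
      lowerCentral-D (suc k) i i+k+1≡d = commSub-least (Z-subgroup i) λ a b a∈γₖ b∈D →
        let i+1+k≡d = P.trans (P.sym (+-suc i k)) i+k+1≡d
            b∈Cᵢ = proj₂ (lower b∈D) i (P.subst (suc i ≤_) i+1+k≡d (m≤m+n (suc i) k)) in
        SubgroupProperties.comm-swap (Z-subgroup i) (proj₂ b∈Cᵢ a (lowerCentral-D k (suc i) i+1+k≡d a a∈γₖ))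

  nilpotent-envelope : ∀ {h} d → Envelope h LowerCentral d
  nilpotent-envelope d = towerArity d + centralisersArity d , towerF d ∧ₚ centralisersF d , λ H subH nilpotent →
    let open Construction H subH
        (a , Z≅φ) = Z-definable d
        (b , W≅ψ) = W-definable d
        D≅φ∧ψ : D d nilpotent ≅ Defined (towerF d ∧ₚ centralisersF d) (a ++ b)
        D≅φ∧ψ = ∩-≅-∧ₚ (towerF d) (centralisersF d) a b Z≅φ W≅ψ in
    a ++ b , subgroup-≅ D≅φ∧ψ (∩-subgroup (Z-subgroup d) (W-subgroup d)) ,
    (λ x x∈H → proj₁ D≅φ∧ψ x (H⊆D d nilpotent x x∈H)) ,
    (λ x x∈γ_d → lower (lowerCentral-D d nilpotent d 0 P.refl x (lowerCentral-mono (proj₂ D≅φ∧ψ) d x x∈γ_d))) ,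
    (λ g g∈NH → normalizer-≅ D≅φ∧ψ g (∩-normalizer g (Z-normalizer d g g∈NH , W-normalizer d g g∈NH)))

lemma2p5 : ExcludedMiddle → ∀ {c ℓ g h : Level} →
    (IccSoluble c ℓ h × IccNilpotent c ℓ h) ×
    (SubIccSoluble c ℓ g h × SubIccNilpotent c ℓ g h)
lemma2p5 lem =
  ( (λ G icc d → envelope-exact G (Derived G) (derived-mono G) (SolubleEnvelope.soluble-envelope lem G icc d))
  , (λ G icc d → envelope-exact G (LowerCentral G) (lowerCentral-mono G)
                   (NilpotentEnvelope.nilpotent-envelope lem G icc d)) )
  , ( (λ X icc G subG d → envelope-relative X (Derived X) (derived-mono X)
                            (SolubleEnvelope.soluble-envelope lem X icc d) G subG)
    , (λ X icc G subG d → envelope-relative X (LowerCentral X) (lowerCentral-mono X)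
                            (NilpotentEnvelope.nilpotent-envelope lem X icc d) G subG) )
  where
  open Envelopes using (envelope-exact; envelope-relative)
  open GroupNotions using (Derived; LowerCentral)
  open GroupTheory using (derived-mono; lowerCentral-mono)
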